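{- Let $m,n\ge1$, let $s_0,\dots,s_m,t_0,\dots,t_n\in\Sigma^*$ and $u_1,\dots,u_m,v_1,\dots,v_n\in\Sigma^+$ be words over an alphabet $\Sigma$. For $i\in\mathbb{N}_0$ let $$U_i=s_0u_1^is_1\cdots u_m^is_m\qquad\text{and}\qquad V_i=t_0v_1^it_1\cdots v_n^it_n.$$ If $U_i=V_i$ holds for $m+n$ distinct values of $i\in\mathbb{N}_0$, then $U_i=V_i$ holds for all $i\in\mathbb{N}_0$. -}

module Defs where

open import Data.Nat using (ℕ; zero; suc)
open import Data.List using (List; []; _++_)
open import Data.Fin using (Fin)
import Data.Fin as F

_^w_ : ∀ {a} {Σ : Set a} → List Σ → ℕ → List Σ
w ^w zero  = []
w ^w suc i = w ++ (w ^w i)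

-- pattern s₀ u₁^i s₁ ⋯ uₘ^i sₘ, with s : Fin (suc m) → List Σ, u : Fin m → List Σ
-- rest m s u i = u₁^i s₁ ⋯ uₘ^i sₘ  (indices shifted: s 0 is handled by 'pat')
rest : ∀ {a} {Σ : Set a} (m : ℕ) → (Fin (suc m) → List Σ) → (Fin m → List Σ) → ℕ → List Σ
rest zero    s u i = []
rest (suc m) s u i = (u F.zero ^w i) ++ (s (F.suc F.zero) ++ rest m (λ k → s (F.suc k)) (λ k → u (F.suc k)) i)

pat : ∀ {a} {Σ : Set a} (m : ℕ) → (Fin (suc m) → List Σ) → (Fin m → List Σ) → ℕ → List Σ
pat m s u i = s F.zero ++ rest m s u i

module Submission where

-- Over the digits 0, …, B − 1 a word is determined by its length and its base-B value. With X = B^i, the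
-- value of U_i times ∏ₖ (B^|uₖ| − 1) is an integer polynomial in X whose exponents are 0 and the prefix sums
-- of |u₁|, …, |uₘ|, and likewise for V_i. Comparing lengths at two of the given indices shows |U_i| = |V_i|
-- for all i and that the uₖ and the vₖ have the same total length, so the difference of the two polynomials
-- has at most m + n exponents. Such a polynomial vanishing at m + n distinct powers of B is zero: at a root
-- B^i the least B-adic valuation of a term is attained twice, so the largest degree attaining it ties with a
-- smaller one and is therefore undercut at every later root; distinct roots thus pick distinct degrees, none
-- of them the smallest, which is impossible. An arbitrary alphabet, which need not have decidable equality,
-- is reduced to digits by labelling every letter of s, u, t, v with its position, identifying the labels that
-- the m + n given equations force to be equal, and choosing B beyond the largest label.

open import Defs
open import Level using (Level)
open import Data.Nat.Base using (ℕ; suc)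
open import Data.Fin.Base using (Fin)
open import Data.List.Base using (List)
open import Relation.Binary.Definitions using (DecidableEquality)

module IntegerPowers where

  open import Data.Nat.Base as ℕ using (zero)
  open import Data.Integer.Base as ℤ using (_*_; _^_)
  open import Data.Integer.Properties using (pos-*)
  open import Relation.Binary.PropositionalEquality

  pos-^ : ∀ a n → (ℤ.+ a) ^ n ≡ ℤ.+ (a ℕ.^ n)
  pos-^ a zero    = refl
  pos-^ a (suc n) = trans (cong ((ℤ.+ a) *_) (pos-^ a n)) (sym (pos-* a (a ℕ.^ n)))

module Polynomials where

  open import Data.Nat.Base as ℕ using (zero)
  import Data.Nat.Divisibility as ℕ
  open import Data.Integer.Base using (ℤ; 0ℤ; 1ℤ; _+_; _*_; _^_; ∣_∣)
  open import Data.Integer.Properties using (_≟_; *-zeroʳ; *-identityˡ; +-identityˡ; +-identityʳ)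
  open import Data.Integer.Divisibility.Signed using (_∣_; ∣ᵤ⇒∣; ∣m∣n⇒∣m+n; ∣n⇒∣m*n)
  open import Data.Integer.Tactic.RingSolver using (solve-∀)
  open import Data.List.Base using (List; []; _∷_; map)
  open import Data.List.Membership.Propositional using (_∈_)
  open import Data.List.Membership.Propositional.Properties using (∈-map⁺; ∈-map⁻)
  open import Data.List.Relation.Binary.Subset.Propositional using (_⊆_)
  open import Data.Product.Base using (_,_)
  open import Data.Empty using (⊥-elim)
  open import Function.Base using (_∘_)
  open import Relation.Binary.PropositionalEquality
  open import Relation.Nullary using (yes; no)

  Poly : Set
  Poly = List ℤ

  eval : Poly → ℤ → ℤ
  eval []      x = 0ℤ
  eval (c ∷ p) x = c + x * eval p x

  coeff : Poly → ℕ → ℤ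
  coeff []      _       = 0ℤ
  coeff (c ∷ p) zero    = c
  coeff (c ∷ p) (suc δ) = coeff p δ

  const : ℤ → Poly
  const c = c ∷ []

  infixl 6 _⊕_
  _⊕_ : Poly → Poly → Poly
  []      ⊕ q       = q
  (a ∷ p) ⊕ []      = a ∷ p
  (a ∷ p) ⊕ (b ∷ q) = (a + b) ∷ (p ⊕ q)

  scale : ℤ → Poly → Poly
  scale c = map (c *_)

  shift : ℕ → Poly → Poly
  shift zero    p = p
  shift (suc d) p = 0ℤ ∷ shift d p

  deleteCoeff : ℕ → Poly → Poly
  deleteCoeff k       []      = []
  deleteCoeff zero    (c ∷ p) = 0ℤ ∷ p
  deleteCoeff (suc k) (c ∷ p) = c ∷ deleteCoeff k p

  eval-const : ∀ c x → eval (const c) x ≡ c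
  eval-const c x = trans (cong (c +_) (*-zeroʳ x)) (+-identityʳ c)

  eval-⊕ : ∀ p q x → eval (p ⊕ q) x ≡ eval p x + eval q x
  eval-⊕ []      q       x = sym (+-identityˡ _)
  eval-⊕ (a ∷ p) []      x = sym (+-identityʳ _)
  eval-⊕ (a ∷ p) (b ∷ q) x =
    trans (cong (λ e → (a + b) + x * e) (eval-⊕ p q x)) (regroup a b x (eval p x) (eval q x))
    where
    regroup : ∀ a b x P Q → (a + b) + x * (P + Q) ≡ (a + x * P) + (b + x * Q)
    regroup = solve-∀

  eval-scale : ∀ c p x → eval (scale c p) x ≡ c * eval p x
  eval-scale c []      x = sym (*-zeroʳ c)
  eval-scale c (a ∷ p) x =
    trans (cong (λ e → c * a + x * e) (eval-scale c p x)) (factor c a x (eval p x))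
    where
    factor : ∀ c a x P → c * a + x * (c * P) ≡ c * (a + x * P)
    factor = solve-∀

  eval-shift : ∀ d p x → eval (shift d p) x ≡ x ^ d * eval p x
  eval-shift zero    p x = sym (*-identityˡ _)
  eval-shift (suc d) p x =
    trans (cong (λ e → 0ℤ + x * e) (eval-shift d p x)) (reassoc x (x ^ d) (eval p x))
    where
    reassoc : ∀ x y P → 0ℤ + x * (y * P) ≡ (x * y) * P
    reassoc = solve-∀

  eval-deleteCoeff : ∀ k p x → eval p x ≡ coeff p k * x ^ k + eval (deleteCoeff k p) x
  eval-deleteCoeff k       []      x = refl
  eval-deleteCoeff zero    (c ∷ p) x = split c x (eval p x)
    where
    split : ∀ c x P → c + x * P ≡ c * 1ℤ + (0ℤ + x * P)
    split = solve-∀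
  eval-deleteCoeff (suc k) (c ∷ p) x =
    trans (cong (λ e → c + x * e) (eval-deleteCoeff k p x))
          (split c (coeff p k) x (x ^ k) (eval (deleteCoeff k p) x))
    where
    split : ∀ c a x y R → c + x * (a * y + R) ≡ a * (x * y) + (c + x * R)
    split = solve-∀

  coeff-deleteCoeff-≡ : ∀ k p → coeff (deleteCoeff k p) k ≡ 0ℤ
  coeff-deleteCoeff-≡ k       []      = refl
  coeff-deleteCoeff-≡ zero    (c ∷ p) = refl
  coeff-deleteCoeff-≡ (suc k) (c ∷ p) = coeff-deleteCoeff-≡ k p

  coeff-deleteCoeff-≢ : ∀ k p {δ} → δ ≢ k → coeff (deleteCoeff k p) δ ≡ coeff p δ
  coeff-deleteCoeff-≢ k       []      δ≢k = refl
  coeff-deleteCoeff-≢ zero    (c ∷ p) {zero}  δ≢k = ⊥-elim (δ≢k refl)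
  coeff-deleteCoeff-≢ zero    (c ∷ p) {suc δ} δ≢k = refl
  coeff-deleteCoeff-≢ (suc k) (c ∷ p) {zero}  δ≢k = refl
  coeff-deleteCoeff-≢ (suc k) (c ∷ p) {suc δ} δ≢k = coeff-deleteCoeff-≢ k p (δ≢k ∘ cong suc)

  eval-coeff≡0 : ∀ p → (∀ δ → coeff p δ ≡ 0ℤ) → ∀ x → eval p x ≡ 0ℤ
  eval-coeff≡0 []      coeff≡0 x = refl
  eval-coeff≡0 (c ∷ p) coeff≡0 x = begin
    c + x * eval p x  ≡⟨ cong₂ (λ a e → a + x * e) (coeff≡0 zero) (eval-coeff≡0 p (coeff≡0 ∘ suc) x) ⟩
    0ℤ + x * 0ℤ       ≡⟨ cong (0ℤ +_) (*-zeroʳ x) ⟩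
    0ℤ                ∎
    where open ≡-Reasoning

  ∣0 : ∀ d → d ∣ 0ℤ
  ∣0 d = ∣ᵤ⇒∣ (∣ d ∣ ℕ.∣0)

  ∣-eval : ∀ d p x → (∀ δ → d ∣ coeff p δ * x ^ δ) → d ∣ eval p x
  ∣-eval d p x ∣terms =
    subst (d ∣_) (*-identityˡ _) (∣-scaled-eval p 1ℤ λ δ → subst (d ∣_) (sym (*-identityˡ _)) (∣terms δ))
    where
    -- the factor y absorbs the powers of x that the recursion peels off
    ∣-scaled-eval : ∀ p y → (∀ δ → d ∣ y * (coeff p δ * x ^ δ)) → d ∣ y * eval p x
    ∣-scaled-eval []      y _      = ∣n⇒∣m*n y (∣0 d)
    ∣-scaled-eval (c ∷ p) y ∣terms =
      subst (d ∣_) (sym (split y c x (eval p x)))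
        (∣m∣n⇒∣m+n (∣terms zero)
          (∣-scaled-eval p (y * x) λ δ → subst (d ∣_) (shuffle y (coeff p δ) x (x ^ δ)) (∣terms (suc δ))))
      where
      split : ∀ y c x P → y * (c + x * P) ≡ y * (c * 1ℤ) + (y * x) * P
      split = solve-∀
      shuffle : ∀ y c x z → y * (c * (x * z)) ≡ (y * x) * (c * z)
      shuffle = solve-∀

  coeff-⊕ : ∀ p q δ → coeff (p ⊕ q) δ ≡ coeff p δ + coeff q δ
  coeff-⊕ []      q       δ       = sym (+-identityˡ _)
  coeff-⊕ (a ∷ p) []      δ       = sym (+-identityʳ _)
  coeff-⊕ (a ∷ p) (b ∷ q) zero    = refl
  coeff-⊕ (a ∷ p) (b ∷ q) (suc δ) = coeff-⊕ p q δ

  coeff-scale : ∀ c p δ → coeff (scale c p) δ ≡ c * coeff p δ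
  coeff-scale c []      δ       = sym (*-zeroʳ c)
  coeff-scale c (a ∷ p) zero    = refl
  coeff-scale c (a ∷ p) (suc δ) = coeff-scale c p δ

  Supported : Poly → List ℕ → Set
  Supported p S = ∀ δ → coeff p δ ≢ 0ℤ → δ ∈ S

  Supported-mono : ∀ {S T} p → S ⊆ T → Supported p S → Supported p T
  Supported-mono p S⊆T supp δ nz = S⊆T (supp δ nz)

  Supported-const : ∀ {S} c → 0 ∈ S → Supported (const c) S
  Supported-const c 0∈S zero    nz = 0∈S
  Supported-const c 0∈S (suc δ) nz = ⊥-elim (nz refl)

  Supported-⊕ : ∀ {S} p q → Supported p S → Supported q S → Supported (p ⊕ q) S
  Supported-⊕ p q supp-p supp-q δ nz with coeff p δ ≟ 0ℤ
  ... | no  p≢0 = supp-p δ p≢0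
  ... | yes p≡0 = supp-q δ λ q≡0 → nz (trans (coeff-⊕ p q δ) (cong₂ _+_ p≡0 q≡0))

  Supported-scale : ∀ {S} c p → Supported p S → Supported (scale c p) S
  Supported-scale c p supp δ nz =
    supp δ λ p≡0 → nz (trans (coeff-scale c p δ) (trans (cong (c *_) p≡0) (*-zeroʳ c)))

  Supported-shift : ∀ {S} d p → Supported p S → Supported (shift d p) (map (d ℕ.+_) S)
  Supported-shift zero    p supp δ       nz = ∈-map⁺ (0 ℕ.+_) (supp δ nz)
  Supported-shift (suc d) p supp zero    nz = ⊥-elim (nz refl)
  Supported-shift (suc d) p supp (suc δ) nz with ∈-map⁻ (d ℕ.+_) (Supported-shift d p supp δ nz)
  ... | δ′ , δ′∈S , refl = ∈-map⁺ (suc d ℕ.+_) δ′∈S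

module Radix (b : ℕ) where

  open import Data.Nat.Base using (_+_; _*_; _^_; _∸_; _<_; _≤_; s≤s; z≤n; ≢-nonZero)
  open import Data.Nat.Properties using (_≟_; *-comm; *-identityʳ; m<m*n; ^-distribˡ-+-*; m^n≢0; m+[n∸m]≡n)
  open import Data.Nat.Divisibility using (_∣_; divides; _∣?_; 1∣_; m∣m*n; *-monoʳ-∣; *-monoˡ-∣; *-cancelˡ-∣)
  open import Data.Nat.Induction using (<-rec)
  open import Data.Product.Base using (Σ; _×_; _,_; proj₁; proj₂)
  open import Data.Empty using (⊥-elim)
  open import Function.Base using (_∘_)
  open import Relation.Binary.PropositionalEquality
  open import Relation.Nullary using (¬_; yes; no)
  import Data.Integer.Base as ℤ

  B : ℕ
  B = suc (suc b)

  X : ℕ → ℤ.ℤ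
  X i = ℤ.+ (B ^ i)

  Multiplicity : ℕ → Set
  Multiplicity n = Σ ℕ λ e → n ≢ 0 → B ^ e ∣ n × ¬ B ^ suc e ∣ n

  -- abstract: keeps type checking from unfolding the well-founded recursion
  abstract
    multiplicity : ∀ n → Multiplicity n
    multiplicity = <-rec Multiplicity step
      where
      step : ∀ n → (∀ {q} → q < n → Multiplicity q) → Multiplicity n
      step n rec with n ≟ 0 | B ∣? n
      ... | yes refl | _ = 0 , λ 0≢0 → ⊥-elim (0≢0 refl)
      ... | no n≢0 | no B∤n = 0 , λ _ → 1∣ n , B∤n ∘ subst (_∣ n) (*-identityʳ B)
      ... | no n≢0 | yes (divides q n≡q*B) = lift (rec q<n)
        where
        n≡B*q : n ≡ B * q
        n≡B*q = trans n≡q*B (*-comm q B)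
        q≢0 : q ≢ 0
        q≢0 refl = n≢0 (trans n≡B*q (*-comm B 0))
        q<n : q < n
        q<n = subst (q <_) (trans (*-comm q B) (sym n≡B*q)) (m<m*n q B {{≢-nonZero q≢0}} (s≤s (s≤s z≤n)))
        lift : Multiplicity q → Multiplicity n
        lift (e , spec) = suc e , λ _ →
          subst (B ^ suc e ∣_) (sym n≡B*q) (*-monoʳ-∣ B (proj₁ (spec q≢0))) ,
          proj₂ (spec q≢0) ∘ *-cancelˡ-∣ B ∘ subst (B ^ suc (suc e) ∣_) n≡B*q

  valuation : ℕ → ℕ
  valuation n = proj₁ (multiplicity n)

  pow-valuation-∣ : ∀ {n} → n ≢ 0 → B ^ valuation n ∣ n
  pow-valuation-∣ {n} n≢0 = proj₁ (proj₂ (multiplicity n) n≢0)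

  pow-suc-valuation-∤ : ∀ {n} → n ≢ 0 → ¬ B ^ suc (valuation n) ∣ n
  pow-suc-valuation-∤ {n} n≢0 = proj₂ (proj₂ (multiplicity n) n≢0)

  pow-valuation+-∣ : ∀ {n} k → n ≢ 0 → B ^ (valuation n + k) ∣ n * B ^ k
  pow-valuation+-∣ {n} k n≢0 =
    subst (_∣ n * B ^ k) (sym (^-distribˡ-+-* B (valuation n) k)) (*-monoˡ-∣ (B ^ k) (pow-valuation-∣ n≢0))

  pow-suc-valuation+-∤ : ∀ {n} k → n ≢ 0 → ¬ B ^ (suc (valuation n) + k) ∣ n * B ^ k
  pow-suc-valuation+-∤ {n} k n≢0 =
    pow-suc-valuation-∤ n≢0 ∘ *-cancelˡ-∣ (B ^ k) {{m^n≢0 B k}}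
      ∘ subst₂ _∣_ (trans (^-distribˡ-+-* B (suc (valuation n)) k) (*-comm _ (B ^ k))) (*-comm n (B ^ k))

  pow-∣-pow : ∀ {m n} → m ≤ n → B ^ m ∣ B ^ n
  pow-∣-pow {m} {n} m≤n =
    subst (B ^ m ∣_) (trans (sym (^-distribˡ-+-* B m (n ∸ m))) (cong (B ^_) (m+[n∸m]≡n m≤n))) (m∣m*n (B ^ (n ∸ m)))

module Counting where

  open import Data.Nat.Base using (_<_; s≤s)
  open import Data.Fin.Base using (punchOut)
  open import Data.Fin.Properties using (injective⇒≤; punchOut-injective)
  open import Function.Base using (_∘_)
  open import Function.Definitions using (Injective)
  open import Relation.Binary.PropositionalEquality

  injective-missing⇒< : ∀ {L N} (f : Fin L → Fin N) → Injective _≡_ _≡_ f →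
                        (p : Fin N) → (∀ j → f j ≢ p) → L < N
  injective-missing⇒< {N = suc N} f f-inj p missed = s≤s (injective⇒≤ {f = λ j → punchOut (missed j ∘ sym)}
    λ {i} {j} → f-inj ∘ punchOut-injective (missed i ∘ sym) (missed j ∘ sym))

module Slopes where

  open import Data.Nat.Base
  open import Data.Nat.Properties
  open import Data.Product.Base using (_×_; _,_)
  open import Data.Empty using (⊥-elim)
  open import Relation.Binary.Definitions using (tri<; tri≈; tri>)
  open import Relation.Binary.PropositionalEquality

  tie-slope-< : ∀ {a c i i′ δ k} → a + i * δ ≡ c + i * k → δ < k → i < i′ → a + i′ * δ < c + i′ * k
  tie-slope-< {a} {c} {i} {i′} {δ} {k} tie δ<k i<i′ = begin-strict
      a + i′ * δ             ≡⟨ cong (λ z → a + z * δ) i′≡i+d ⟩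
      a + (i + d) * δ        ≡⟨ cong (a +_) (*-distribʳ-+ δ i d) ⟩
      a + (i * δ + d * δ)    ≡⟨ +-assoc a (i * δ) (d * δ) ⟨
      (a + i * δ) + d * δ    ≡⟨ cong (_+ d * δ) tie ⟩
      (c + i * k) + d * δ    <⟨ +-monoʳ-< (c + i * k) (*-monoʳ-< d δ<k) ⟩
      (c + i * k) + d * k    ≡⟨ +-assoc c (i * k) (d * k) ⟩
      c + (i * k + d * k)    ≡⟨ cong (c +_) (*-distribʳ-+ k i d) ⟨
      c + (i + d) * k        ≡⟨ cong (λ z → c + z * k) i′≡i+d ⟨
      c + i′ * k             ∎
    where
    open ≤-Reasoning
    d = i′ ∸ i
    i′≡i+d : i′ ≡ i + d
    i′≡i+d = sym (m+[n∸m]≡n (<⇒≤ i<i′))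
    instance
      d≢0 : NonZero d
      d≢0 = >-nonZero (m<n⇒0<n∸m i<i′)

  private
    affine-agree-< : ∀ {a c d e i j} → i < j → a + i * d ≡ c + i * e → a + j * d ≡ c + j * e → a ≡ c × d ≡ e
    affine-agree-< {a} {c} {d} {e} {i} i<j at-i at-j with <-cmp d e
    ... | tri< d<e _ _ = ⊥-elim (<-irrefl at-j (tie-slope-< at-i d<e i<j))
    ... | tri> _ _ e<d = ⊥-elim (<-irrefl (sym at-j) (tie-slope-< (sym at-i) e<d i<j))
    ... | tri≈ _ refl _ = +-cancelʳ-≡ (i * d) a c at-i , refl

  affine-agree : ∀ {a c d e i j} → i ≢ j → a + i * d ≡ c + i * e → a + j * d ≡ c + j * e → a ≡ c × d ≡ e
  affine-agree {i = i} {j} i≢j at-i at-j with <-cmp i j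
  ... | tri< i<j _ _ = affine-agree-< i<j at-i at-j
  ... | tri≈ _ i≡j _ = ⊥-elim (i≢j i≡j)
  ... | tri> _ _ j<i = affine-agree-< j<i at-j at-i

module SparseRoots (b : ℕ) (F : Polynomials.Poly) (S : List ℕ) (F-supp : Polynomials.Supported F S) where

  open import Data.Nat.Base using (_+_; _*_; _^_; _≤_; _<_)
  open import Data.Nat.Properties
    using (_≟_; _≤?_; ≤-decTotalOrder; ≤-totalOrder; ^-*-assoc; <⇒≱; ≤∧≢⇒<; ≰⇒>; <-cmp; <-irrefl;
           ≤-<-trans; ≤-reflexive; ≤-antisym)
  open import Data.Integer.Base as ℤ using (ℤ; +_; 0ℤ; ∣_∣)
  import Data.Integer.Properties as ℤ
  import Data.Nat.Divisibility as ℕ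
  open import Data.Integer.Divisibility.Signed using (_∣_; ∣ᵤ⇒∣; ∣⇒∣ᵤ; ∣-trans; ∣m+n∣n⇒∣m)
  open import Data.List.Base using (length; filter)
  open import Data.List.Membership.Propositional using (_∈_; lose)
  open import Data.List.Membership.Propositional.Properties using (∈-filter⁺; ∈-filter⁻)
  open import Data.List.Relation.Unary.All as All using (All)
  open import Data.List.Relation.Unary.Any using (index; satisfied; any?)
  open import Data.List.Membership.Setoid.Properties using (index-injective)
  import Data.List.Extrema.Nat as ℕExtrema
  open import Data.Product.Base using (Σ; _×_; _,_; proj₁; proj₂)
  open import Data.Product.Relation.Binary.Lex.NonStrict using (×-totalOrder)
  open import Data.Sum.Base using (inj₁; inj₂)
  open import Data.Empty using (⊥-elim)
  open import Function.Base using (_∘_)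
  open import Function.Definitions using (Injective)
  open import Relation.Binary.Definitions using (tri<; tri≈; tri>)
  import Relation.Binary.Construct.Flip.Ord as Flip
  open import Relation.Binary.PropositionalEquality
  open import Relation.Nullary using (¬_; Dec; yes; no; ¬?)
  open import Relation.Nullary.Decidable using (_×-dec_)

  open Polynomials
  open IntegerPowers
  open Radix b
  open Counting
  open Slopes

  Active : ℕ → Set
  Active δ = coeff F δ ≢ 0ℤ

  active? : ∀ δ → Dec (Active δ)
  active? δ = ¬? (coeff F δ ℤ.≟ 0ℤ)

  -- the B-adic valuation of the term coeff F δ · X i ^ δ
  weight : ℕ → ℕ → ℕ
  weight i δ = valuation ∣ coeff F δ ∣ + i * δ

  term : ℕ → ℕ → ℤ
  term i δ = coeff F δ ℤ.* X i ℤ.^ δ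

  ∣term∣ : ∀ i δ → ∣ term i δ ∣ ≡ ∣ coeff F δ ∣ * B ^ (i * δ)
  ∣term∣ i δ = trans (ℤ.abs-* (coeff F δ) _)
    (cong (∣ coeff F δ ∣ *_) (trans (cong ∣_∣ (pos-^ (B ^ i) δ)) (^-*-assoc B i δ)))

  pow-weight-∣-term : ∀ i δ → Active δ → + B ^ weight i δ ∣ term i δ
  pow-weight-∣-term i δ active =
    ∣ᵤ⇒∣ (subst (B ^ weight i δ ℕ.∣_) (sym (∣term∣ i δ))
           (pow-valuation+-∣ (i * δ) (active ∘ ℤ.∣i∣≡0⇒i≡0)))

  pow-suc-weight-∤-term : ∀ i δ → Active δ → ¬ + B ^ suc (weight i δ) ∣ term i δ
  pow-suc-weight-∤-term i δ active =
    pow-suc-valuation+-∤ (i * δ) (active ∘ ℤ.∣i∣≡0⇒i≡0)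
      ∘ subst (B ^ suc (weight i δ) ℕ.∣_) (∣term∣ i δ) ∘ ∣⇒∣ᵤ

  unique-min-weight⇒eval≢0 : ∀ i k → Active k → (∀ δ → Active δ → δ ≢ k → weight i k < weight i δ) →
                             eval F (X i) ≢ 0ℤ
  unique-min-weight⇒eval≢0 i k active-k k-unique eval≡0 = pow-suc-weight-∤-term i k active-k D∣term-k
    where
    D : ℤ
    D = + B ^ suc (weight i k)
    D∣other : ∀ δ → D ∣ coeff (deleteCoeff k F) δ ℤ.* X i ℤ.^ δ
    D∣other δ with δ ≟ k | coeff F δ ℤ.≟ 0ℤ
    ... | yes refl | _ = subst (λ c → D ∣ c ℤ.* X i ℤ.^ δ) (sym (coeff-deleteCoeff-≡ k F)) (∣0 D)
    ... | no δ≢k | yes c≡0 =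
      subst (λ c → D ∣ c ℤ.* X i ℤ.^ δ) (sym (trans (coeff-deleteCoeff-≢ k F δ≢k) c≡0)) (∣0 D)
    ... | no δ≢k | no active =
      subst (λ c → D ∣ c ℤ.* X i ℤ.^ δ) (sym (coeff-deleteCoeff-≢ k F δ≢k))
        (∣-trans (∣ᵤ⇒∣ (pow-∣-pow (k-unique δ active δ≢k))) (pow-weight-∣-term i δ active))
    D∣term-k : D ∣ term i k
    D∣term-k = ∣m+n∣n⇒∣m (subst (D ∣_) (trans (sym eval≡0) (eval-deleteCoeff k F (X i))) (∣0 D))
                         (∣-eval D (deleteCoeff k F) (X i) D∣other)

  -- Among the degrees of minimal weight the largest one wins.
  open import Data.List.Extrema (×-totalOrder ≤-decTotalOrder (Flip.totalOrder ≤-totalOrder))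
    using (argmin; argmin-all; f[argmin]≤f[xs])

  key : ℕ → ℕ → ℕ × ℕ
  key i δ = weight i δ , δ

  actives : List ℕ
  actives = filter active? S

  actives-active : All (λ δ → δ ∈ S × Active δ) actives
  actives-active = All.tabulate (∈-filter⁻ active?)

  module _ (δ₀ : ℕ) (active-δ₀ : Active δ₀) where

    top : ℕ → ℕ
    top i = argmin (key i) δ₀ actives

    top-active : ∀ i → top i ∈ S × Active (top i)
    top-active i = argmin-all (key i) (F-supp δ₀ active-δ₀ , active-δ₀) actives-active

    top-minimal : ∀ i δ → Active δ → weight i (top i) ≤ weight i δ × (weight i (top i) ≡ weight i δ → δ ≤ top i)
    top-minimal i δ active with All.lookup (f[argmin]≤f[xs] δ₀ actives) (∈-filter⁺ active? (F-supp δ active) active)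
    ... | inj₁ (w≤ , w≢) = w≤ , ⊥-elim ∘ w≢
    ... | inj₂ (w≡ , δ≤) = ≤-reflexive w≡ , λ _ → δ≤

    tie-below-top : ∀ i → eval F (X i) ≡ 0ℤ → Σ ℕ λ δ → Active δ × δ < top i × weight i δ ≡ weight i (top i)
    tie-below-top i eval≡0 with any? (λ δ → active? δ ×-dec ¬? (δ ≟ top i) ×-dec weight i δ ≤? weight i (top i)) S
    ... | yes found with satisfied found
    ...   | δ , active , δ≢top , w≤ with top-minimal i δ active
    ...     | w≥ , tie⇒δ≤top = δ , active , ≤∧≢⇒< (tie⇒δ≤top w≡) δ≢top , sym w≡
      where w≡ = ≤-antisym w≥ w≤
    tie-below-top i eval≡0 | no none =
      ⊥-elim (unique-min-weight⇒eval≢0 i (top i) (proj₂ (top-active i)) top-unique eval≡0)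
      where
      top-unique : ∀ δ → Active δ → δ ≢ top i → weight i (top i) < weight i δ
      top-unique δ active δ≢top = ≰⇒> λ w≤ → none (lose (F-supp δ active) (active , δ≢top , w≤))

    top-separates : ∀ {i i′} → eval F (X i) ≡ 0ℤ → i < i′ → top i ≢ top i′
    top-separates {i} {i′} root i<i′ top≡ with tie-below-top i root
    ... | δ , active , δ<top , tie =
      <⇒≱ (subst (λ t → weight i′ δ < weight i′ t) top≡ (tie-slope-< tie δ<top i<i′))
          (proj₁ (top-minimal i′ δ active))

    bottom : ℕ
    bottom = ℕExtrema.min δ₀ actives

    bottom-active : bottom ∈ S × Active bottom
    bottom-active = ℕExtrema.argmin-all (λ δ → δ) (F-supp δ₀ active-δ₀ , active-δ₀) actives-active

    top≢bottom : ∀ i → eval F (X i) ≡ 0ℤ → top i ≢ bottom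
    top≢bottom i root top≡bottom with tie-below-top i root
    ... | δ , active , δ<top , _ = <-irrefl (sym top≡bottom) (≤-<-trans bottom≤δ δ<top)
      where
      bottom≤δ : bottom ≤ δ
      bottom≤δ = All.lookup (ℕExtrema.min≤xs δ₀ actives) (∈-filter⁺ active? (F-supp δ active) active)

    module _ {L} (I : Fin L → ℕ) (I-injective : Injective _≡_ _≡_ I) (roots : ∀ j → eval F (X (I j)) ≡ 0ℤ) where

      top-injective : ∀ {j j′} → top (I j) ≡ top (I j′) → j ≡ j′
      top-injective {j} {j′} top≡ with <-cmp (I j) (I j′)
      ... | tri< I<I′ _ _ = ⊥-elim (top-separates (roots j) I<I′ top≡)
      ... | tri≈ _ I≡I′ _ = I-injective I≡I′
      ... | tri> _ _ I>I′ = ⊥-elim (top-separates (roots j′) I>I′ (sym top≡))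

      position : Fin L → Fin (length S)
      position j = index (proj₁ (top-active (I j)))

      fewer-roots-than-support : L < length S
      fewer-roots-than-support =
        injective-missing⇒< position (top-injective ∘ index-injective (setoid ℕ) _ _) (index (proj₁ bottom-active))
          λ j → top≢bottom (I j) (roots j) ∘ index-injective (setoid ℕ) _ _

  coefficients-vanish : ∀ {L} (I : Fin L → ℕ) → Injective _≡_ _≡_ I → length S ≤ L →
                        (∀ j → eval F (X (I j)) ≡ 0ℤ) → ∀ δ → coeff F δ ≡ 0ℤ
  coefficients-vanish I I-injective S≤L roots δ with coeff F δ ℤ.≟ 0ℤ
  ... | yes c≡0 = c≡0
  ... | no active = ⊥-elim (<⇒≱ (fewer-roots-than-support δ active I I-injective roots) S≤L)

module Patterns {a} {A : Set a} where

  open import Data.Nat.Base using (zero; _+_; _*_)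
  open import Data.Nat.Properties using (*-zeroʳ; +-assoc)
  open import Data.Nat.Tactic.RingSolver using (solve-∀)
  open import Data.Nat.ListAction using (sum)
  import Data.Fin.Base as Fin
  open import Data.List.Base using (_++_; length; tabulate)
  open import Data.List.Properties using (length-++)
  open import Function.Base using (_∘_)
  open import Relation.Binary.PropositionalEquality

  lengths : ∀ {k} → (Fin k → List A) → List ℕ
  lengths w = tabulate (length ∘ w)

  totalLength : ∀ {k} → (Fin k → List A) → ℕ
  totalLength w = sum (lengths w)

  length-^w : ∀ (w : List A) i → length (w ^w i) ≡ i * length w
  length-^w w zero    = refl
  length-^w w (suc i) = trans (length-++ w) (cong (length w +_) (length-^w w i))

  length-rest : ∀ m s u i → length (rest m s u i) ≡ totalLength (s ∘ Fin.suc) + i * totalLength u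
  length-rest zero    s u i = sym (*-zeroʳ i)
  length-rest (suc m) s u i = begin
    length ((u Fin.zero ^w i) ++ (s₁ ++ rest m (s ∘ Fin.suc) (u ∘ Fin.suc) i))
      ≡⟨ trans (length-++ (u Fin.zero ^w i)) (cong₂ _+_ (length-^w (u Fin.zero) i) (length-++ s₁)) ⟩
    i * length (u Fin.zero) + (length s₁ + length (rest m (s ∘ Fin.suc) (u ∘ Fin.suc) i))
      ≡⟨ cong (λ r → i * length (u Fin.zero) + (length s₁ + r)) (length-rest m (s ∘ Fin.suc) (u ∘ Fin.suc) i) ⟩
    i * length (u Fin.zero) + (length s₁ + (totalLength (s ∘ Fin.suc ∘ Fin.suc) + i * totalLength (u ∘ Fin.suc)))
      ≡⟨ regroup i (length (u Fin.zero)) (length s₁) (totalLength (s ∘ Fin.suc ∘ Fin.suc)) (totalLength (u ∘ Fin.suc)) ⟩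
    totalLength (s ∘ Fin.suc) + i * totalLength u ∎
    where
    open ≡-Reasoning
    s₁ = s (Fin.suc Fin.zero)
    regroup : ∀ i l s₁ c L → i * l + (s₁ + (c + i * L)) ≡ (s₁ + c) + i * (l + L)
    regroup = solve-∀

  length-pat : ∀ m s u i → length (pat m s u i) ≡ totalLength s + i * totalLength u
  length-pat m s u i = trans (length-++ (s Fin.zero))
    (trans (cong (length (s Fin.zero) +_) (length-rest m s u i)) (sym (+-assoc (length (s Fin.zero)) _ _)))

  rest-cong : ∀ m {s s′ : Fin (suc m) → List A} {u u′ : Fin m → List A} i →
              (∀ k → s k ≡ s′ k) → (∀ k → u k ≡ u′ k) → rest m s u i ≡ rest m s′ u′ i
  rest-cong zero    i s≗s′ u≗u′ = refl
  rest-cong (suc m) i s≗s′ u≗u′ =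
    cong₂ _++_ (cong (_^w i) (u≗u′ Fin.zero))
      (cong₂ _++_ (s≗s′ (Fin.suc Fin.zero)) (rest-cong m i (s≗s′ ∘ Fin.suc) (u≗u′ ∘ Fin.suc)))

  pat-cong : ∀ m {s s′ : Fin (suc m) → List A} {u u′ : Fin m → List A} i →
             (∀ k → s k ≡ s′ k) → (∀ k → u k ≡ u′ k) → pat m s u i ≡ pat m s′ u′ i
  pat-cong m i s≗s′ u≗u′ = cong₂ _++_ (s≗s′ Fin.zero) (rest-cong m i s≗s′ u≗u′)

module _ {a b} {A : Set a} {C : Set b} (f : A → C) where

  open import Data.Nat.Base using (zero)
  import Data.Fin.Base as Fin
  open import Data.List.Base using (_++_; map)
  open import Data.List.Properties using (map-++)
  open import Function.Base using (_∘_)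
  open import Relation.Binary.PropositionalEquality

  map-^w : ∀ w i → map f (w ^w i) ≡ map f w ^w i
  map-^w w zero    = refl
  map-^w w (suc i) = trans (map-++ f w (w ^w i)) (cong (map f w ++_) (map-^w w i))

  map-rest : ∀ m s u i → map f (rest m s u i) ≡ rest m (map f ∘ s) (map f ∘ u) i
  map-rest zero    s u i = refl
  map-rest (suc m) s u i =
    trans (map-++ f (u Fin.zero ^w i) _)
      (cong₂ _++_ (map-^w (u Fin.zero) i)
        (trans (map-++ f (s (Fin.suc Fin.zero)) _)
          (cong (map f (s (Fin.suc Fin.zero)) ++_) (map-rest m (s ∘ Fin.suc) (u ∘ Fin.suc) i))))

  map-pat : ∀ m s u i → map f (pat m s u i) ≡ pat m (map f ∘ s) (map f ∘ u) i
  map-pat m s u i = trans (map-++ f (s Fin.zero) _) (cong (map f (s Fin.zero) ++_) (map-rest m s u i))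

  map-pat-decode : ∀ m {s′ : Fin (suc m) → List A} {s : Fin (suc m) → List C}
                     {u′ : Fin m → List A} {u : Fin m → List C} →
                   (∀ k → map f (s′ k) ≡ s k) → (∀ k → map f (u′ k) ≡ u k) →
                   ∀ i → map f (pat m s′ u′ i) ≡ pat m s u i
  map-pat-decode m {s′} {u′ = u′} s′≗s u′≗u i = trans (map-pat m s′ u′ i) (Patterns.pat-cong m i s′≗s u′≗u)

module Digits (b : ℕ) where

  open import Data.Nat.Base using (_+_; _*_; _^_; _<_)
  open import Data.Nat.Properties using (*-identityˡ; *-comm; +-cancelˡ-≡; *-cancelˡ-≡; suc-injective)
  open import Data.Nat.DivMod using (_%_; [m+kn]%n≡m%n; m<n⇒m%n≡m)
  open import Data.Nat.Tactic.RingSolver using (solve-∀)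
  open import Data.List.Base using ([]; _∷_; _++_; length)
  open import Data.List.Relation.Unary.All using (All; []; _∷_)
  open import Data.Product.Base using (_×_; _,_)
  open import Relation.Binary.PropositionalEquality

  open Radix b using (B)

  value : List ℕ → ℕ
  value []      = 0
  value (d ∷ w) = d + B * value w

  value-++ : ∀ w w′ → value (w ++ w′) ≡ value w + B ^ length w * value w′
  value-++ []      w′ = sym (*-identityˡ (value w′))
  value-++ (d ∷ w) w′ =
    trans (cong (λ v → d + B * v) (value-++ w w′)) (regroup d B (value w) (B ^ length w) (value w′))
    where
    regroup : ∀ d B v p v′ → d + B * (v + p * v′) ≡ (d + B * v) + (B * p) * v′
    regroup = solve-∀

  digit-unique : ∀ {d d′ y y′} → d < B → d′ < B → d + B * y ≡ d′ + B * y′ → d ≡ d′ × y ≡ y′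
  digit-unique {d} {d′} {y} {y′} d<B d′<B eq =
    d≡d′ , *-cancelˡ-≡ y y′ B (+-cancelˡ-≡ d _ _ (trans eq (cong (_+ B * y′) (sym d≡d′))))
    where
    digit : ∀ {d} y → d < B → (d + B * y) % B ≡ d
    digit {d} y d<B = trans (cong (λ z → (d + z) % B) (*-comm B y)) (trans ([m+kn]%n≡m%n d y B) (m<n⇒m%n≡m d<B))
    d≡d′ : d ≡ d′
    d≡d′ = trans (sym (digit y d<B)) (trans (cong (_% B) eq) (digit y′ d′<B))

  value-injective : ∀ {w w′} → length w ≡ length w′ → All (_< B) w → All (_< B) w′ →
                    value w ≡ value w′ → w ≡ w′
  value-injective {[]}    {[]}     _   _          _            _  = refl
  value-injective {d ∷ w} {d′ ∷ w′} |w|≡ (d<B ∷ w<B) (d′<B ∷ w′<B) eq with digit-unique d<B d′<B eq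
  ... | refl , value≡ = cong (d ∷_) (value-injective (suc-injective |w|≡) w<B w′<B value≡)

module PrefixSums where

  open import Data.Nat.Base using (_+_)
  open import Data.Nat.Properties using (+-identityʳ)
  open import Data.Nat.ListAction using (sum)
  open import Data.List.Base using ([]; _∷_; map; length)
  open import Data.List.Properties using (length-map)
  open import Data.List.Membership.Propositional using (_∈_)
  open import Data.List.Membership.Propositional.Properties using (∈-map⁺; ∈-map⁻)
  open import Data.List.Relation.Unary.Any using (here; there)
  open import Data.Product.Base using (_,_)
  open import Data.Sum.Base using (_⊎_; inj₁; inj₂)
  open import Relation.Binary.PropositionalEquality

  prefixSums : List ℕ → List ℕ
  prefixSums []       = []
  prefixSums (l ∷ ls) = l ∷ map (l +_) (prefixSums ls)

  properPrefixSums : List ℕ → List ℕ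
  properPrefixSums []            = []
  properPrefixSums (l ∷ [])      = []
  properPrefixSums (l ∷ l′ ∷ ls) = l ∷ map (l +_) (properPrefixSums (l′ ∷ ls))

  length-prefixSums : ∀ ls → length (prefixSums ls) ≡ length ls
  length-prefixSums []       = refl
  length-prefixSums (l ∷ ls) = cong suc (trans (length-map (l +_) (prefixSums ls)) (length-prefixSums ls))

  length-properPrefixSums : ∀ l ls → length (properPrefixSums (l ∷ ls)) ≡ length ls
  length-properPrefixSums l []        = refl
  length-properPrefixSums l (l′ ∷ ls) =
    cong suc (trans (length-map (l +_) (properPrefixSums (l′ ∷ ls))) (length-properPrefixSums l′ ls))

  sum∈prefixSums : ∀ l ls → sum (l ∷ ls) ∈ prefixSums (l ∷ ls)
  sum∈prefixSums l []        = here (+-identityʳ l)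
  sum∈prefixSums l (l′ ∷ ls) = there (∈-map⁺ (l +_) (sum∈prefixSums l′ ls))

  ∈prefixSums⇒proper⊎sum : ∀ l ls {x} → x ∈ prefixSums (l ∷ ls) →
                           x ∈ properPrefixSums (l ∷ ls) ⊎ x ≡ sum (l ∷ ls)
  ∈prefixSums⇒proper⊎sum l []        (here refl) = inj₂ (sym (+-identityʳ l))
  ∈prefixSums⇒proper⊎sum l (l′ ∷ ls) (here refl) = inj₁ (here refl)
  ∈prefixSums⇒proper⊎sum l (l′ ∷ ls) (there x∈) with ∈-map⁻ (l +_) x∈
  ... | y , y∈ , refl with ∈prefixSums⇒proper⊎sum l′ ls y∈
  ...   | inj₁ y∈proper = inj₁ (there (∈-map⁺ (l +_) y∈proper))
  ...   | inj₂ refl     = inj₂ refl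

module PatternPolynomial (b : ℕ) where

  open import Data.Nat.Base as ℕ using (zero)
  open import Data.Sum.Base using (inj₁; inj₂)
  import Data.Nat.Properties as ℕ
  open import Data.Integer.Base using (ℤ; +_; 0ℤ; 1ℤ; _+_; _*_; _^_; _-_; -_)
  import Data.Integer.Properties as ℤ
  open import Data.Integer.Tactic.RingSolver using (solve-∀)
  open import Data.List.Base using ([]; _∷_; _++_; length; map)
  open import Data.List.Membership.Propositional using (_∈_)
  open import Data.List.Membership.Propositional.Properties using (∈-map⁺)
  open import Data.List.Relation.Binary.Subset.Propositional using (_⊆_)
  open import Data.List.Relation.Unary.Any using (here; there)
  open import Data.Empty using (⊥-elim)
  import Data.Fin.Base as Fin
  open import Function.Base using (_∘_)
  open import Relation.Binary.PropositionalEquality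

  open Polynomials
  open IntegerPowers
  open Patterns using (length-^w; lengths)
  open PrefixSums using (prefixSums)
  open Radix b using (B; X)
  open Digits b using (value; value-++)

  ⟦_⟧ : List ℕ → ℤ
  ⟦ w ⟧ = + value w

  β : ℤ
  β = + B

  ⟦⟧-++ : ∀ w w′ → ⟦ w ++ w′ ⟧ ≡ ⟦ w ⟧ + β ^ length w * ⟦ w′ ⟧
  ⟦⟧-++ w w′ = trans (cong +_ (value-++ w w′)) (trans (ℤ.pos-+ (value w) _) (cong (λ z → ⟦ w ⟧ + z)
    (trans (ℤ.pos-* (B ℕ.^ length w) _) (cong (_* ⟦ w′ ⟧) (sym (pos-^ B (length w)))))))

  X^≡β^* : ∀ i l → X i ^ l ≡ β ^ (i ℕ.* l)
  X^≡β^* i l = trans (pos-^ (B ℕ.^ i) l) (trans (cong +_ (ℕ.^-*-assoc B i l)) (sym (pos-^ B (i ℕ.* l))))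

  geometric : ∀ u i → (β ^ length u - 1ℤ) * ⟦ u ^w i ⟧ ≡ ⟦ u ⟧ * (β ^ (i ℕ.* length u) - 1ℤ)
  geometric u zero    = vanish (β ^ length u) ⟦ u ⟧
    where
    vanish : ∀ y v → (y - 1ℤ) * 0ℤ ≡ v * (1ℤ - 1ℤ)
    vanish = solve-∀
  geometric u (suc i) = begin
    (Y - 1ℤ) * ⟦ u ++ (u ^w i) ⟧             ≡⟨ cong ((Y - 1ℤ) *_) (⟦⟧-++ u (u ^w i)) ⟩
    (Y - 1ℤ) * (⟦ u ⟧ + Y * ⟦ u ^w i ⟧)      ≡⟨ distribute Y ⟦ u ⟧ ⟦ u ^w i ⟧ ⟩
    (Y - 1ℤ) * ⟦ u ⟧ + Y * ((Y - 1ℤ) * ⟦ u ^w i ⟧)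
      ≡⟨ cong (λ z → (Y - 1ℤ) * ⟦ u ⟧ + Y * z) (geometric u i) ⟩
    (Y - 1ℤ) * ⟦ u ⟧ + Y * (⟦ u ⟧ * (β ^ (i ℕ.* length u) - 1ℤ))
      ≡⟨ telescope Y ⟦ u ⟧ (β ^ (i ℕ.* length u)) ⟩
    ⟦ u ⟧ * (Y * β ^ (i ℕ.* length u) - 1ℤ)
      ≡⟨ cong (λ z → ⟦ u ⟧ * (z - 1ℤ)) (sym (ℤ.^-distribˡ-+-* β (length u) (i ℕ.* length u))) ⟩
    ⟦ u ⟧ * (β ^ (suc i ℕ.* length u) - 1ℤ) ∎
    where
    open ≡-Reasoning
    Y = β ^ length u
    distribute : ∀ Y v A → (Y - 1ℤ) * (v + Y * A) ≡ (Y - 1ℤ) * v + Y * ((Y - 1ℤ) * A)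
    distribute = solve-∀
    telescope : ∀ Y v T → (Y - 1ℤ) * v + Y * (v * (T - 1ℤ)) ≡ v * (Y * T - 1ℤ)
    telescope = solve-∀

  -- G u = ∏ₖ (B^|uₖ| − 1) clears the denominators of the geometric sums val(uₖ^i).
  G : ∀ {m} → (Fin m → List ℕ) → ℤ
  G {zero}  u = 1ℤ
  G {suc m} u = (β ^ length (u Fin.zero) - 1ℤ) * G (u ∘ Fin.suc)

  xpow-1 : ℕ → Poly
  xpow-1 l = shift l (const 1ℤ) ⊕ const (- 1ℤ)

  eval-xpow-1 : ∀ l x → eval (xpow-1 l) x ≡ x ^ l - 1ℤ
  eval-xpow-1 l x = begin
    eval (shift l (const 1ℤ) ⊕ const (- 1ℤ)) x        ≡⟨ eval-⊕ (shift l (const 1ℤ)) (const (- 1ℤ)) x ⟩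
    eval (shift l (const 1ℤ)) x + eval (const (- 1ℤ)) x
      ≡⟨ cong₂ _+_ (trans (eval-shift l (const 1ℤ) x) (cong (x ^ l *_) (eval-const 1ℤ x))) (eval-const (- 1ℤ) x) ⟩
    x ^ l * 1ℤ + - 1ℤ                                   ≡⟨ cong (_- 1ℤ) (ℤ.*-identityʳ (x ^ l)) ⟩
    x ^ l - 1ℤ ∎
    where open ≡-Reasoning

  extend : ℤ → ℕ → ℤ → ℤ → Poly → Poly
  extend a l d c P = scale a (xpow-1 l) ⊕ shift l (const d ⊕ scale c P)

  eval-extend : ∀ a l d c P x → eval (extend a l d c P) x ≡ a * (x ^ l - 1ℤ) + x ^ l * (d + c * eval P x)
  eval-extend a l d c P x = begin
    eval (extend a l d c P) x
      ≡⟨ eval-⊕ (scale a (xpow-1 l)) (shift l (const d ⊕ scale c P)) x ⟩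
    eval (scale a (xpow-1 l)) x + eval (shift l (const d ⊕ scale c P)) x
      ≡⟨ cong₂ _+_ (trans (eval-scale a (xpow-1 l) x) (cong (a *_) (eval-xpow-1 l x)))
                   (trans (eval-shift l (const d ⊕ scale c P) x) (cong (x ^ l *_) (eval-⊕ (const d) (scale c P) x))) ⟩
    a * (x ^ l - 1ℤ) + x ^ l * (eval (const d) x + eval (scale c P) x)
      ≡⟨ cong (λ e → a * (x ^ l - 1ℤ) + x ^ l * e) (cong₂ _+_ (eval-const d x) (eval-scale c P x)) ⟩
    a * (x ^ l - 1ℤ) + x ^ l * (d + c * eval P x) ∎
    where open ≡-Reasoning

  restPoly : ∀ m → (Fin (suc m) → List ℕ) → (Fin m → List ℕ) → Poly
  restPoly zero    s u = []
  restPoly (suc m) s u =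
    extend (G (u ∘ Fin.suc) * ⟦ u Fin.zero ⟧) (length (u Fin.zero)) (G u * ⟦ s (Fin.suc Fin.zero) ⟧)
           ((β ^ length (u Fin.zero) - 1ℤ) * β ^ length (s (Fin.suc Fin.zero))) (restPoly m (s ∘ Fin.suc) (u ∘ Fin.suc))

  eval-restPoly : ∀ m s u i → G u * ⟦ rest m s u i ⟧ ≡ eval (restPoly m s u) (X i)
  eval-restPoly zero    s u i = refl
  eval-restPoly (suc m) s u i = begin
    (g * G′) * ⟦ (u₀ ^w i) ++ (s₁ ++ R) ⟧
      ≡⟨ cong ((g * G′) *_) (trans (⟦⟧-++ (u₀ ^w i) (s₁ ++ R))
           (cong₂ (λ y r → ⟦ u₀ ^w i ⟧ + y * r) β^|u₀^i|≡Y (⟦⟧-++ s₁ R))) ⟩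
    (g * G′) * (⟦ u₀ ^w i ⟧ + Y * (⟦ s₁ ⟧ + β ^ length s₁ * ⟦ R ⟧))
      ≡⟨ distribute g G′ ⟦ u₀ ^w i ⟧ Y ⟦ s₁ ⟧ (β ^ length s₁) ⟦ R ⟧ ⟩
    G′ * (g * ⟦ u₀ ^w i ⟧) + Y * ((g * G′) * ⟦ s₁ ⟧ + (g * β ^ length s₁) * (G′ * ⟦ R ⟧))
      ≡⟨ cong₂ (λ a r → G′ * a + Y * ((g * G′) * ⟦ s₁ ⟧ + (g * β ^ length s₁) * r))
           (trans (geometric u₀ i) (cong (λ y → ⟦ u₀ ⟧ * (y - 1ℤ)) (sym (X^≡β^* i l))))
           (eval-restPoly m (s ∘ Fin.suc) (u ∘ Fin.suc) i) ⟩
    G′ * (⟦ u₀ ⟧ * (Y - 1ℤ)) + Y * ((g * G′) * ⟦ s₁ ⟧ + (g * β ^ length s₁) * eval P x)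
      ≡⟨ cong (_+ Y * ((g * G′) * ⟦ s₁ ⟧ + (g * β ^ length s₁) * eval P x))
              (sym (ℤ.*-assoc G′ ⟦ u₀ ⟧ (Y - 1ℤ))) ⟩
    (G′ * ⟦ u₀ ⟧) * (Y - 1ℤ) + Y * ((g * G′) * ⟦ s₁ ⟧ + (g * β ^ length s₁) * eval P x)
      ≡⟨ eval-extend (G′ * ⟦ u₀ ⟧) l ((g * G′) * ⟦ s₁ ⟧) (g * β ^ length s₁) P x ⟨
    eval (restPoly (suc m) s u) x ∎
    where
    open ≡-Reasoning
    u₀ = u Fin.zero
    s₁ = s (Fin.suc Fin.zero)
    R = rest m (s ∘ Fin.suc) (u ∘ Fin.suc) i
    P = restPoly m (s ∘ Fin.suc) (u ∘ Fin.suc)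
    l = length u₀
    x = X i
    Y = x ^ l
    g = β ^ l - 1ℤ
    G′ = G (u ∘ Fin.suc)
    β^|u₀^i|≡Y : β ^ length (u₀ ^w i) ≡ Y
    β^|u₀^i|≡Y = trans (cong (β ^_) (length-^w u₀ i)) (sym (X^≡β^* i l))
    distribute : ∀ g G′ A Y S b R →
                 (g * G′) * (A + Y * (S + b * R)) ≡ G′ * (g * A) + Y * ((g * G′) * S + (g * b) * (G′ * R))
    distribute = solve-∀

  xpow-1-supported : ∀ {S} l → 0 ∈ S → l ∈ S → Supported (xpow-1 l) S
  xpow-1-supported {S} l 0∈S l∈S =
    Supported-⊕ (shift l (const 1ℤ)) (const (- 1ℤ))
      (Supported-mono (shift l (const 1ℤ)) (λ { (here refl) → subst (_∈ S) (sym (ℕ.+-identityʳ l)) l∈S ; (there ()) })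
        (Supported-shift l (const 1ℤ) (Supported-const {S = 0 ∷ []} 1ℤ (here refl))))
      (Supported-const (- 1ℤ) 0∈S)

  extend-supported : ∀ {S T} a l d c P → 0 ∈ S → 0 ∈ T → map (l ℕ.+_) T ⊆ S → Supported P T →
                     Supported (extend a l d c P) S
  extend-supported {S} {T} a l d c P 0∈S 0∈T lT⊆S P-supp =
    Supported-⊕ (scale a (xpow-1 l)) (shift l (const d ⊕ scale c P))
      (Supported-scale a (xpow-1 l) (xpow-1-supported l 0∈S l∈S))
      (Supported-mono (shift l (const d ⊕ scale c P)) lT⊆S (Supported-shift l (const d ⊕ scale c P)
        (Supported-⊕ {T} (const d) (scale c P) (Supported-const d 0∈T) (Supported-scale c P P-supp))))
    where
    l∈S : l ∈ S
    l∈S = subst (_∈ S) (ℕ.+-identityʳ l) (lT⊆S (∈-map⁺ (l ℕ.+_) 0∈T))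

  restPoly-supported : ∀ m s u → Supported (restPoly m s u) (0 ∷ prefixSums (lengths u))
  restPoly-supported zero    s u δ nz = ⊥-elim (nz refl)
  restPoly-supported (suc m) s u =
    extend-supported (G (u ∘ Fin.suc) * ⟦ u Fin.zero ⟧) l (G u * ⟦ s (Fin.suc Fin.zero) ⟧)
      ((β ^ l - 1ℤ) * β ^ length (s (Fin.suc Fin.zero))) (restPoly m (s ∘ Fin.suc) (u ∘ Fin.suc))
      (here refl) (here refl) shifted⊆
      (restPoly-supported m (s ∘ Fin.suc) (u ∘ Fin.suc))
    where
    l = length (u Fin.zero)
    shifted⊆ : map (l ℕ.+_) (0 ∷ prefixSums (lengths (u ∘ Fin.suc))) ⊆ 0 ∷ prefixSums (lengths u)
    shifted⊆ (here refl) = there (here (ℕ.+-identityʳ l))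
    shifted⊆ (there x∈)  = there (there x∈)

  patternPoly : ∀ m → (Fin (suc m) → List ℕ) → (Fin m → List ℕ) → Poly
  patternPoly m s u = const (G u * ⟦ s Fin.zero ⟧) ⊕ scale (β ^ length (s Fin.zero)) (restPoly m s u)

  eval-patternPoly : ∀ m s u i → G u * ⟦ pat m s u i ⟧ ≡ eval (patternPoly m s u) (X i)
  eval-patternPoly m s u i = begin
    G u * ⟦ s₀ ++ rest m s u i ⟧
      ≡⟨ cong (G u *_) (⟦⟧-++ s₀ (rest m s u i)) ⟩
    G u * (⟦ s₀ ⟧ + β ^ length s₀ * ⟦ rest m s u i ⟧)
      ≡⟨ distribute (G u) ⟦ s₀ ⟧ (β ^ length s₀) ⟦ rest m s u i ⟧ ⟩
    G u * ⟦ s₀ ⟧ + β ^ length s₀ * (G u * ⟦ rest m s u i ⟧)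
      ≡⟨ cong₂ _+_ (sym (eval-const (G u * ⟦ s₀ ⟧) (X i)))
                   (trans (cong (β ^ length s₀ *_) (eval-restPoly m s u i))
                          (sym (eval-scale (β ^ length s₀) (restPoly m s u) (X i)))) ⟩
    eval (const (G u * ⟦ s₀ ⟧)) (X i) + eval (scale (β ^ length s₀) (restPoly m s u)) (X i)
      ≡⟨ eval-⊕ (const (G u * ⟦ s₀ ⟧)) (scale (β ^ length s₀) (restPoly m s u)) (X i) ⟨
    eval (patternPoly m s u) (X i) ∎
    where
    open ≡-Reasoning
    s₀ = s Fin.zero
    distribute : ∀ G S b R → G * (S + b * R) ≡ G * S + b * (G * R)
    distribute = solve-∀

  patternPoly-supported : ∀ m s u → Supported (patternPoly m s u) (0 ∷ prefixSums (lengths u))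
  patternPoly-supported m s u =
    Supported-⊕ (const (G u * ⟦ s Fin.zero ⟧)) (scale (β ^ length (s Fin.zero)) (restPoly m s u))
      (Supported-const (G u * ⟦ s Fin.zero ⟧) (here refl))
      (Supported-scale (β ^ length (s Fin.zero)) (restPoly m s u) (restPoly-supported m s u))

  β^-1≢0 : ∀ {l} → l ≢ 0 → β ^ l - 1ℤ ≢ 0ℤ
  β^-1≢0 {l} l≢0 β^l-1≡0
    with ℕ.m^n≡1⇒n≡0∨m≡1 B l (ℤ.+-injective (trans (sym (pos-^ B l)) (ℤ.i-j≡0⇒i≡j _ _ β^l-1≡0)))
  ... | inj₁ l≡0 = l≢0 l≡0
  ... | inj₂ ()

  G≢0 : ∀ {m} (u : Fin m → List ℕ) → (∀ k → u k ≢ []) → G u ≢ 0ℤ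
  G≢0 {zero}  u u≢[] ()
  G≢0 {suc m} u u≢[] G≡0 with ℤ.i*j≡0⇒i≡0∨j≡0 (β ^ length (u Fin.zero) - 1ℤ) G≡0
  ... | inj₁ factor≡0 = β^-1≢0 (u≢[] Fin.zero ∘ length≡0) factor≡0
    where
    length≡0 : ∀ {w : List ℕ} → length w ≡ 0 → w ≡ []
    length≡0 {[]} _ = refl
  ... | inj₂ rest≡0 = G≢0 (u ∘ Fin.suc) (u≢[] ∘ Fin.suc) rest≡0

module DigitPatterns (b : ℕ) where

  open import Data.Nat.Base using (_+_; _*_; _<_)
  open import Data.Nat.Properties using (≤-reflexive; +-suc)
  open import Data.Integer.Base as ℤ using (ℤ; 0ℤ)
  import Data.Integer.Properties as ℤ
  open import Data.Fin.Base using (_↑ʳ_)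
  import Data.Fin.Base as Fin
  open import Data.List.Base using ([]; _∷_; _++_; length)
  open import Data.List.Properties using (length-++; length-tabulate)
  open import Data.List.Membership.Propositional using (_∈_)
  open import Data.List.Membership.Propositional.Properties using (∈-++⁺ˡ; ∈-++⁺ʳ)
  open import Data.List.Relation.Unary.All using (All)
  open import Data.List.Relation.Unary.Any using (here; there)
  open import Data.List.Relation.Binary.Subset.Propositional using (_⊆_)
  open import Data.Integer.Tactic.RingSolver using (solve-∀)
  open import Data.Product.Base using (_×_; proj₁; proj₂)
  open import Data.Sum.Base using (inj₁; inj₂)
  open import Data.Empty using (⊥-elim)
  open import Function.Base using (_∘_)
  open import Function.Definitions using (Injective)
  open import Relation.Binary.PropositionalEquality

  open Polynomials
  open Radix b using (B; X)
  open Digits b using (value; value-injective)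
  open PatternPolynomial b
  open PrefixSums
  open Patterns
  open Slopes using (affine-agree)

  module _ {m n} (s : Fin (suc (suc m)) → List ℕ) (u : Fin (suc m) → List ℕ)
                 (t : Fin (suc (suc n)) → List ℕ) (v : Fin (suc n) → List ℕ)
                 (I : Fin (suc m + suc n) → ℕ) (I-injective : Injective _≡_ _≡_ I)
                 (agree : ∀ j → pat (suc m) s u (I j) ≡ pat (suc n) t v (I j)) where

    private
      U V : ℕ → List ℕ
      U = pat (suc m) s u
      V = pat (suc n) t v

    totalLengths-agree : totalLength s ≡ totalLength t × totalLength u ≡ totalLength v
    totalLengths-agree =
      affine-agree (λ I≡ → 0≢1 (I-injective I≡)) (length-at Fin.zero) (length-at (Fin.suc (m ↑ʳ Fin.zero)))
      where
      0≢1 : Fin.zero ≢ Fin.suc (m ↑ʳ Fin.zero)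
      0≢1 ()
      length-at : ∀ j → totalLength s + I j * totalLength u ≡ totalLength t + I j * totalLength v
      length-at j = trans (sym (length-pat (suc m) s u (I j))) (trans (cong length (agree j)) (length-pat (suc n) t v (I j)))

    length-agree : ∀ i → length (U i) ≡ length (V i)
    length-agree i = begin
      length (U i)                       ≡⟨ length-pat (suc m) s u i ⟩
      totalLength s + i * totalLength u
        ≡⟨ cong₂ (λ a d → a + i * d) (proj₁ totalLengths-agree) (proj₂ totalLengths-agree) ⟩
      totalLength t + i * totalLength v  ≡⟨ length-pat (suc n) t v i ⟨
      length (V i)                       ∎
      where open ≡-Reasoning

    -- The full sum of v's lengths is already a prefix sum of u's lengths, which keeps the support at m + n degrees.
    support : List ℕ
    support = 0 ∷ (prefixSums (lengths u) ++ properPrefixSums (lengths v))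

    length-support : length support ≡ suc m + suc n
    length-support = cong suc (begin
      length (prefixSums (lengths u) ++ properPrefixSums (lengths v))
        ≡⟨ length-++ (prefixSums (lengths u)) ⟩
      length (prefixSums (lengths u)) + length (properPrefixSums (lengths v))
        ≡⟨ cong₂ _+_ (trans (length-prefixSums (lengths u)) (length-tabulate (length ∘ u)))
                     (trans (length-properPrefixSums (length (v Fin.zero)) (lengths (v ∘ Fin.suc)))
                            (length-tabulate (length ∘ v ∘ Fin.suc))) ⟩
      suc m + n
        ≡⟨ +-suc m n ⟨
      m + suc n ∎)
      where open ≡-Reasoning

    u-support⊆ : 0 ∷ prefixSums (lengths u) ⊆ support
    u-support⊆ (here refl) = here refl
    u-support⊆ (there x∈)  = there (∈-++⁺ˡ x∈)

    v-support⊆ : 0 ∷ prefixSums (lengths v) ⊆ support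
    v-support⊆ (here refl) = here refl
    v-support⊆ (there x∈) with ∈prefixSums⇒proper⊎sum (length (v Fin.zero)) (lengths (v ∘ Fin.suc)) x∈
    ... | inj₁ x∈proper = there (∈-++⁺ʳ (prefixSums (lengths u)) x∈proper)
    ... | inj₂ refl     = there (∈-++⁺ˡ (subst (_∈ prefixSums (lengths u)) (proj₂ totalLengths-agree)
                                          (sum∈prefixSums (length (u Fin.zero)) (lengths (u ∘ Fin.suc)))))

    difference : Poly
    difference = scale (G v) (patternPoly (suc m) s u) ⊕ scale (ℤ.- G u) (patternPoly (suc n) t v)

    difference-supported : Supported difference support
    difference-supported =
      Supported-⊕ (scale (G v) (patternPoly (suc m) s u)) (scale (ℤ.- G u) (patternPoly (suc n) t v))
        (Supported-scale (G v) (patternPoly (suc m) s u)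
          (Supported-mono (patternPoly (suc m) s u) u-support⊆ (patternPoly-supported (suc m) s u)))
        (Supported-scale (ℤ.- G u) (patternPoly (suc n) t v)
          (Supported-mono (patternPoly (suc n) t v) v-support⊆ (patternPoly-supported (suc n) t v)))

    eval-difference : ∀ i → eval difference (X i) ≡ (G u ℤ.* G v) ℤ.* (⟦ U i ⟧ ℤ.- ⟦ V i ⟧)
    eval-difference i = begin
      eval difference (X i)
        ≡⟨ eval-⊕ (scale (G v) (patternPoly (suc m) s u)) (scale (ℤ.- G u) (patternPoly (suc n) t v)) (X i) ⟩
      eval (scale (G v) (patternPoly (suc m) s u)) (X i) ℤ.+ eval (scale (ℤ.- G u) (patternPoly (suc n) t v)) (X i)
        ≡⟨ cong₂ ℤ._+_ (trans (eval-scale (G v) (patternPoly (suc m) s u) (X i))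
                              (cong (G v ℤ.*_) (sym (eval-patternPoly (suc m) s u i))))
                       (trans (eval-scale (ℤ.- G u) (patternPoly (suc n) t v) (X i))
                              (cong (ℤ.- G u ℤ.*_) (sym (eval-patternPoly (suc n) t v i)))) ⟩
      G v ℤ.* (G u ℤ.* ⟦ U i ⟧) ℤ.+ ℤ.- G u ℤ.* (G v ℤ.* ⟦ V i ⟧)
        ≡⟨ factor (G u) (G v) ⟦ U i ⟧ ⟦ V i ⟧ ⟩
      (G u ℤ.* G v) ℤ.* (⟦ U i ⟧ ℤ.- ⟦ V i ⟧) ∎
      where
      open ≡-Reasoning
      factor : ∀ a b x y → b ℤ.* (a ℤ.* x) ℤ.+ ℤ.- a ℤ.* (b ℤ.* y) ≡ (a ℤ.* b) ℤ.* (x ℤ.- y)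
      factor = solve-∀

    roots : ∀ j → eval difference (X (I j)) ≡ 0ℤ
    roots j = begin
      eval difference (X (I j))
        ≡⟨ eval-difference (I j) ⟩
      (G u ℤ.* G v) ℤ.* (⟦ U (I j) ⟧ ℤ.- ⟦ V (I j) ⟧)
        ≡⟨ cong (λ w → (G u ℤ.* G v) ℤ.* (⟦ U (I j) ⟧ ℤ.- ⟦ w ⟧)) (agree j) ⟨
      (G u ℤ.* G v) ℤ.* (⟦ U (I j) ⟧ ℤ.- ⟦ U (I j) ⟧)
        ≡⟨ cong ((G u ℤ.* G v) ℤ.*_) (ℤ.+-inverseʳ ⟦ U (I j) ⟧) ⟩
      (G u ℤ.* G v) ℤ.* 0ℤ
        ≡⟨ ℤ.*-zeroʳ (G u ℤ.* G v) ⟩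
      0ℤ ∎
      where open ≡-Reasoning

    difference-vanishes : ∀ δ → coeff difference δ ≡ 0ℤ
    difference-vanishes =
      SparseRoots.coefficients-vanish b difference support difference-supported I I-injective (≤-reflexive length-support) roots

    values-agree : (∀ k → u k ≢ []) → (∀ k → v k ≢ []) → ∀ i → value (U i) ≡ value (V i)
    values-agree u≢[] v≢[] i = ℤ.+-injective (ℤ.i-j≡0⇒i≡j ⟦ U i ⟧ ⟦ V i ⟧
      (*-cancel-nonzero (G≢0 u u≢[]) (G≢0 v v≢[])
        (trans (sym (eval-difference i)) (eval-coeff≡0 difference difference-vanishes (X i)))))
      where
      *-cancel-nonzero : ∀ {a b d} → a ≢ 0ℤ → b ≢ 0ℤ → (a ℤ.* b) ℤ.* d ≡ 0ℤ → d ≡ 0ℤ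
      *-cancel-nonzero {a} {b} a≢0 b≢0 abd≡0 with ℤ.i*j≡0⇒i≡0∨j≡0 (a ℤ.* b) abd≡0
      ... | inj₂ d≡0 = d≡0
      ... | inj₁ ab≡0 with ℤ.i*j≡0⇒i≡0∨j≡0 a ab≡0
      ...   | inj₁ a≡0 = ⊥-elim (a≢0 a≡0)
      ...   | inj₂ b≡0 = ⊥-elim (b≢0 b≡0)

    pattern-equation-digits : (∀ k → u k ≢ []) → (∀ k → v k ≢ []) →
                              ∀ i → All (_< B) (U i) → All (_< B) (V i) → U i ≡ V i
    pattern-equation-digits u≢[] v≢[] i U<B V<B = value-injective (length-agree i) U<B V<B (values-agree u≢[] v≢[] i)

module Labelling {a} {A : Set a} (default : A) where

  open import Data.Nat.Base using (zero; _+_)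
  import Data.Fin.Base as Fin
  open import Data.List.Base using ([]; _∷_; _++_; length; map; concat; tabulate; upTo; applyUpTo)
  open import Data.List.Properties using (map-upTo; map-∘; map-cong)
  open import Function.Base using (_∘_)
  open import Relation.Binary.PropositionalEquality

  decode : List A → ℕ → A
  decode []       p       = default
  decode (x ∷ xs) zero    = x
  decode (x ∷ xs) (suc p) = decode xs p

  decode-++ : ∀ xs ys p → decode (xs ++ ys) (length xs + p) ≡ decode ys p
  decode-++ []       ys p = refl
  decode-++ (x ∷ xs) ys p = decode-++ xs ys p

  decode-prefix : ∀ xs ys → applyUpTo (decode (xs ++ ys)) (length xs) ≡ xs
  decode-prefix []       ys = refl
  decode-prefix (x ∷ xs) ys = cong (x ∷_) (decode-prefix xs ys)

  labels : ∀ {k} → (Fin k → List A) → Fin k → List ℕ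
  labels w Fin.zero    = upTo (length (w Fin.zero))
  labels w (Fin.suc j) = map (length (w Fin.zero) +_) (labels (w ∘ Fin.suc) j)

  decode-labels : ∀ {k} (w : Fin k → List A) j → map (decode (concat (tabulate w))) (labels w j) ≡ w j
  decode-labels w Fin.zero = trans (map-upTo _ (length (w Fin.zero))) (decode-prefix (w Fin.zero) _)
  decode-labels w (Fin.suc j) = begin
    map (decode (w Fin.zero ++ others)) (map (length (w Fin.zero) +_) (labels (w ∘ Fin.suc) j))
      ≡⟨ map-∘ (labels (w ∘ Fin.suc) j) ⟨
    map (decode (w Fin.zero ++ others) ∘ (length (w Fin.zero) +_)) (labels (w ∘ Fin.suc) j)
      ≡⟨ map-cong (decode-++ (w Fin.zero) others) (labels (w ∘ Fin.suc) j) ⟩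
    map (decode others) (labels (w ∘ Fin.suc) j)
      ≡⟨ decode-labels (w ∘ Fin.suc) j ⟩
    w (Fin.suc j) ∎
    where
    open ≡-Reasoning
    others = concat (tabulate (w ∘ Fin.suc))

module Identification {a} {A : Set a} (_≟_ : DecidableEquality A) where

  open import Data.List.Base using ([]; _∷_)
  open import Data.List.Membership.Propositional using (_∈_)
  open import Data.List.Relation.Unary.All using (All; _∷_)
  open import Data.List.Relation.Unary.Any using (here; there)
  open import Data.Product.Base using (_×_; _,_)
  open import Data.Empty using (⊥-elim)
  open import Function.Base using (_∘_)
  open import Relation.Binary.PropositionalEquality
  open import Relation.Nullary using (yes; no)

  redirect : A → A → A → A
  redirect from to x with x ≟ from
  ... | yes _ = to
  ... | no  _ = x

  redirect-from : ∀ from to → redirect from to from ≡ to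
  redirect-from from to with from ≟ from
  ... | yes _     = refl
  ... | no  f≢f   = ⊥-elim (f≢f refl)

  redirect-to : ∀ from to → redirect from to to ≡ to
  redirect-to from to with to ≟ from
  ... | yes _ = refl
  ... | no  _ = refl

  -- union–find: r maps each element to the representative of its class, and each pair merges two classes
  identify : List (A × A) → (A → A) → A → A
  identify []             r = r
  identify ((x , y) ∷ es) r = identify es (redirect (r y) (r x) ∘ r)

  identify-resp : ∀ es r {x y} → r x ≡ r y → identify es r x ≡ identify es r y
  identify-resp []             r eq = eq
  identify-resp ((x , y) ∷ es) r eq = identify-resp es (redirect (r y) (r x) ∘ r) (cong (redirect (r y) (r x)) eq)

  identify-identifies : ∀ es r {x y} → (x , y) ∈ es → identify es r x ≡ identify es r y
  identify-identifies ((x , y) ∷ es) r (here refl) =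
    identify-resp es (redirect (r y) (r x) ∘ r) (trans (redirect-to (r y) (r x)) (sym (redirect-from (r y) (r x))))
  identify-identifies (_ ∷ es) r (there xy∈) = identify-identifies es _ xy∈

  identify-invariant : ∀ {c} {C : Set c} (g : A → C) es r → All (λ (x , y) → g x ≡ g y) es →
                       (∀ x → g (r x) ≡ g x) → ∀ x → g (identify es r x) ≡ g x
  identify-invariant g []             r _             g∘r≗g = g∘r≗g
  identify-invariant g ((x , y) ∷ es) r (gx≡gy ∷ valid) g∘r≗g =
    identify-invariant g es (redirect (r y) (r x) ∘ r) valid g∘r′≗g
    where
    g∘r′≗g : ∀ z → g (redirect (r y) (r x) (r z)) ≡ g z
    g∘r′≗g z with r z ≟ r y
    ... | yes rz≡ry = trans (g∘r≗g x) (trans gx≡gy (trans (sym (g∘r≗g y)) (trans (cong g (sym rz≡ry)) (g∘r≗g z))))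
    ... | no  _     = g∘r≗g z

module _ {a c} {A : Set a} {C : Set c} (f : A → C) where

  open import Data.List.Base using ([]; _∷_; map; zip; length)
  open import Data.List.Membership.Propositional using (_∈_)
  open import Data.List.Relation.Unary.All using (All; []; _∷_)
  open import Data.List.Relation.Unary.Any using (here; there)
  open import Data.Nat.Properties using (suc-injective)
  open import Data.List.Properties using (∷-injective)
  open import Data.Product.Base using (_,_; proj₁; proj₂)
  open import Function.Base using (_∘_)
  open import Relation.Binary.PropositionalEquality

  zip-agree : ∀ xs ys → map f xs ≡ map f ys → All (λ (x , y) → f x ≡ f y) (zip xs ys)
  zip-agree []       ys       _  = []
  zip-agree (x ∷ xs) []       _  = []
  zip-agree (x ∷ xs) (y ∷ ys) eq = proj₁ (∷-injective eq) ∷ zip-agree xs ys (proj₂ (∷-injective eq))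

  map-≡-zip : ∀ xs ys → length xs ≡ length ys → (∀ {x y} → (x , y) ∈ zip xs ys → f x ≡ f y) →
              map f xs ≡ map f ys
  map-≡-zip []       []       _     _       = refl
  map-≡-zip (x ∷ xs) (y ∷ ys) |x|≡ agree =
    cong₂ _∷_ (agree (here refl)) (map-≡-zip xs ys (suc-injective |x|≡) (agree ∘ there))

open import Data.Nat.Base using (_+_; _<_; _≥_; s≤s)
open import Data.Nat.Properties using (m≤n⇒m≤1+n)
open import Data.List.Base using ([]; _∷_; _++_; map)
open import Data.List.Extrema.Nat using (max; xs≤max)
open import Data.List.Relation.Unary.All as All using (All)
import Data.List.Relation.Unary.All.Properties as All
open import Data.Empty using (⊥-elim)
import Data.Fin.Base as Fin
open import Function.Base using (_∘_)
open import Function.Definitions using (Injective)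
open import Relation.Binary.PropositionalEquality

module Relabelling {a} {Σ : Set a} (g : ℕ → Σ) {k} (xs ys : Fin k → List ℕ)
                   (agree : ∀ j → map g (xs j) ≡ map g (ys j)) where

  open import Data.Nat.Properties using (_≟_)
  open import Data.List.Base using (zip; concat; tabulate; length)
  open import Data.List.Properties using (map-∘; map-cong; length-map)
  import Data.List.Relation.Unary.Any.Properties as Any
  open import Data.Product.Base using (_×_)
  open import Function.Base using (id)

  open Identification _≟_

  equations : Fin k → List (ℕ × ℕ)
  equations j = zip (xs j) (ys j)

  rep : ℕ → ℕ
  rep = identify (concat (tabulate equations)) id

  g∘rep≗g : ∀ x → g (rep x) ≡ g x
  g∘rep≗g = identify-invariant g (concat (tabulate equations)) id
              (All.concat⁺ (All.tabulate⁺ λ j → zip-agree g (xs j) (ys j) (agree j))) λ _ → refl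

  map-g∘rep : ∀ w → map g (map rep w) ≡ map g w
  map-g∘rep w = trans (sym (map-∘ w)) (map-cong g∘rep≗g w)

  rep-agree : ∀ j → map rep (xs j) ≡ map rep (ys j)
  rep-agree j = map-≡-zip rep (xs j) (ys j) same-length
    (identify-identifies (concat (tabulate equations)) id ∘ Any.concat⁺ ∘ Any.tabulate⁺ {f = equations} j)
    where
    same-length : length (xs j) ≡ length (ys j)
    same-length = trans (sym (length-map g (xs j))) (trans (cong length (agree j)) (length-map g (ys j)))

pattern-equation-labels :
  ∀ {a} {Σ : Set a} (g : ℕ → Σ) {m n} (s : Fin (suc (suc m)) → List ℕ) (u : Fin (suc m) → List ℕ)
    (t : Fin (suc (suc n)) → List ℕ) (v : Fin (suc n) → List ℕ) →
  (∀ k → u k ≢ []) → (∀ k → v k ≢ []) →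
  (I : Fin (suc m + suc n) → ℕ) → Injective _≡_ _≡_ I →
  (∀ j → map g (pat (suc m) s u (I j)) ≡ map g (pat (suc n) t v (I j))) →
  ∀ i → map g (pat (suc m) s u i) ≡ map g (pat (suc n) t v i)
pattern-equation-labels g {m} {n} s u t v u≢[] v≢[] I I-injective agree i = begin
  map g (pat (suc m) s u i)            ≡⟨ map-g∘rep (pat (suc m) s u i) ⟨
  map g (map rep (pat (suc m) s u i))  ≡⟨ cong (map g) (map-pat rep (suc m) s u i) ⟩
  map g U′                             ≡⟨ cong (map g) (pattern-equation-digits M s′ u′ t′ v′ I I-injective agree′
                                                          (rep-nonempty ∘ u≢[]) (rep-nonempty ∘ v≢[]) i U′<B V′<B) ⟩
  map g V′                             ≡⟨ cong (map g) (map-pat rep (suc n) t v i) ⟨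
  map g (map rep (pat (suc n) t v i))  ≡⟨ map-g∘rep (pat (suc n) t v i) ⟩
  map g (pat (suc n) t v i)            ∎
  where
  open ≡-Reasoning
  open Relabelling g (pat (suc m) s u ∘ I) (pat (suc n) t v ∘ I) agree
  open DigitPatterns using (pattern-equation-digits)
  s′ = map rep ∘ s
  u′ = map rep ∘ u
  t′ = map rep ∘ t
  v′ = map rep ∘ v
  agree′ : ∀ j → pat (suc m) s′ u′ (I j) ≡ pat (suc n) t′ v′ (I j)
  agree′ j = trans (sym (map-pat rep (suc m) s u (I j))) (trans (rep-agree j) (map-pat rep (suc n) t v (I j)))
  rep-nonempty : ∀ {w : List ℕ} → w ≢ [] → map rep w ≢ []
  rep-nonempty {[]}    w≢[] _ = w≢[] refl
  rep-nonempty {_ ∷ _} _      ()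
  U′ V′ : List ℕ
  U′ = pat (suc m) s′ u′ i
  V′ = pat (suc n) t′ v′ i
  M : ℕ
  M = max 0 (U′ ++ V′)
  U′<B : All (_< suc (suc M)) U′
  U′<B = All.map (s≤s ∘ m≤n⇒m≤1+n) (All.++⁻ˡ U′ (xs≤max 0 (U′ ++ V′)))
  V′<B : All (_< suc (suc M)) V′
  V′<B = All.map (s≤s ∘ m≤n⇒m≤1+n) (All.++⁻ʳ U′ (xs≤max 0 (U′ ++ V′)))

module LabelledPatterns {a} {Σ : Set a} (letter : Σ) {m n : ℕ}
                        (s : Fin (suc (suc m)) → List Σ) (u : Fin (suc m) → List Σ)
                        (t : Fin (suc (suc n)) → List Σ) (v : Fin (suc n) → List Σ) where

  open import Data.Fin.Base using (_↑ˡ_; _↑ʳ_)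
  open import Data.List.Base using (concat; tabulate)
  import Data.Vec.Functional as Vector
  open import Data.Vec.Functional.Properties using (lookup-++ˡ; lookup-++ʳ)

  open Labelling letter

  words : Fin ((suc (suc m) + suc m) + (suc (suc n) + suc n)) → List Σ
  words = (s Vector.++ u) Vector.++ (t Vector.++ v)

  g : ℕ → Σ
  g = decode (concat (tabulate words))

  s′ : Fin (suc (suc m)) → List ℕ
  s′ k = labels words ((k ↑ˡ suc m) ↑ˡ (suc (suc n) + suc n))

  u′ : Fin (suc m) → List ℕ
  u′ k = labels words ((suc (suc m) ↑ʳ k) ↑ˡ (suc (suc n) + suc n))

  t′ : Fin (suc (suc n)) → List ℕ
  t′ k = labels words ((suc (suc m) + suc m) ↑ʳ (k ↑ˡ suc n))

  v′ : Fin (suc n) → List ℕ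
  v′ k = labels words ((suc (suc m) + suc m) ↑ʳ (suc (suc n) ↑ʳ k))

  s′-decodes : ∀ k → map g (s′ k) ≡ s k
  s′-decodes k =
    trans (decode-labels words ((k ↑ˡ suc m) ↑ˡ (suc (suc n) + suc n)))
          (trans (lookup-++ˡ (s Vector.++ u) (t Vector.++ v) (k ↑ˡ suc m)) (lookup-++ˡ s u k))

  u′-decodes : ∀ k → map g (u′ k) ≡ u k
  u′-decodes k =
    trans (decode-labels words ((suc (suc m) ↑ʳ k) ↑ˡ (suc (suc n) + suc n)))
          (trans (lookup-++ˡ (s Vector.++ u) (t Vector.++ v) (suc (suc m) ↑ʳ k)) (lookup-++ʳ s u k))

  t′-decodes : ∀ k → map g (t′ k) ≡ t k
  t′-decodes k =
    trans (decode-labels words ((suc (suc m) + suc m) ↑ʳ (k ↑ˡ suc n)))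
          (trans (lookup-++ʳ (s Vector.++ u) (t Vector.++ v) (k ↑ˡ suc n)) (lookup-++ˡ t v k))

  v′-decodes : ∀ k → map g (v′ k) ≡ v k
  v′-decodes k =
    trans (decode-labels words ((suc (suc m) + suc m) ↑ʳ (suc (suc n) ↑ʳ k)))
          (trans (lookup-++ʳ (s Vector.++ u) (t Vector.++ v) (suc (suc n) ↑ʳ k)) (lookup-++ʳ t v k))

  u′≢[] : (∀ k → u k ≢ []) → ∀ k → u′ k ≢ []
  u′≢[] u≢[] k u′≡[] = u≢[] k (trans (sym (u′-decodes k)) (cong (map g) u′≡[]))

  v′≢[] : (∀ k → v k ≢ []) → ∀ k → v′ k ≢ []
  v′≢[] v≢[] k v′≡[] = v≢[] k (trans (sym (v′-decodes k)) (cong (map g) v′≡[]))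

theorem8 : ∀ {a : Level} {Σ : Set a} (m n : ℕ) → m ≥ 1 → n ≥ 1 →
    (s : Fin (suc m) → List Σ) (u : Fin m → List Σ) →
    (t : Fin (suc n) → List Σ) (v : Fin n → List Σ) →
    (∀ k → u k ≢ []) → (∀ k → v k ≢ []) →
    (I : Fin (m + n) → ℕ) → Injective _≡_ _≡_ I →
    (∀ j → pat m s u (I j) ≡ pat n t v (I j)) →
    ∀ i → pat m s u i ≡ pat n t v i
theorem8 {Σ = Σ} (suc m) (suc n) _ _ s u t v u≢[] v≢[] I I-injective agree i = begin
  pat (suc m) s u i             ≡⟨ map-pat-decode g (suc m) s′-decodes u′-decodes i ⟨
  map g (pat (suc m) s′ u′ i)
    ≡⟨ pattern-equation-labels g s′ u′ t′ v′ (u′≢[] u≢[]) (v′≢[] v≢[]) I I-injective agree′ i ⟩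
  map g (pat (suc n) t′ v′ i)   ≡⟨ map-pat-decode g (suc n) t′-decodes v′-decodes i ⟩
  pat (suc n) t v i             ∎
  where
  open ≡-Reasoning
  -- decoding needs a default letter, and Σ itself may be empty
  letter : Σ
  letter with u Fin.zero | u≢[] Fin.zero
  ... | []    | u₀≢[] = ⊥-elim (u₀≢[] refl)
  ... | x ∷ _ | _     = x
  open LabelledPatterns letter s u t v
  agree′ : ∀ j → map g (pat (suc m) s′ u′ (I j)) ≡ map g (pat (suc n) t′ v′ (I j))
  agree′ j = trans (map-pat-decode g (suc m) s′-decodes u′-decodes (I j))
                   (trans (agree j) (sym (map-pat-decode g (suc n) t′-decodes v′-decodes (I j))))
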